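{- Let $n\geq 1$ and let $\mathbf{c}^{(1)},\ldots,\mathbf{c}^{(n)}\in\mathbb{R}^n$ be the minimal standard concave vectors. Then $\mathbf{c}^{(1)},\ldots,\mathbf{c}^{(n)}$ form a basis of $\mathbb{R}^n$, and every positive concave vector $\mathbf{c}\in\mathbb{R}^n$ can be written uniquely as $$\mathbf{c}=\lambda_1\mathbf{c}^{(1)}+\cdots+\lambda_n\mathbf{c}^{(n)}$$ with $\lambda_1,\ldots,\lambda_n\geq 0$.
   Context: A vector $\mathbf{a}=(a_1,\ldots,a_n)\in\mathbb{R}^n$ is positive if $a_i\geq 0$ for all $1\leq i\leq n$, convex if $a_{i+1}-2a_i+a_{i-1}\geq 0$ for all $1<i<n$, and concave if $-\mathbf{a}$ is convex. Let $C$ be the set of positive concave vectors in $\mathbb{R}^n$ whose maximal component value is $1$. For $1\le i\le n$, $\mathbf{c}^{(i)}$ denotes the minimal element (in the componentwise order) of $C$ whose $i$-th component equals $1$; explicitly, for $n=1$, $\mathbf{c}^{(1)}=(1)$, and for $n\geq 2$, $c^{(i)}_j=\frac{j-1}{i-1}$ for $j\le i$ (when $i>1$) and $c^{(i)}_j=\frac{n-j}{n-i}$ for $j\geq i$ (when $i<n$). Thus $c^{(i)}_1,\ldots,c^{(i)}_i$ is an arithmetic progression from $0$ to $1$ and $c^{(i)}_i,\ldots,c^{(i)}_n$ is an arithmetic progression from $1$ to $0$ (with $\mathbf{c}^{(1)}$ decreasing from $1$ to $0$ and $\mathbf{c}^{(n)}$ increasing from $0$ to $1$). These are called the minimal standard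 concave vectors. -}

module Defs where

open import Level using (Level; _⊔_) renaming (suc to lsuc)
open import Data.Nat using (ℕ; zero; suc; _∸_; _≤?_; _≟_)
open import Data.Fin using (Fin; toℕ) renaming (zero to fzero; suc to fsuc)
open import Data.Product using (Σ; _×_; _,_)
open import Relation.Nullary using (¬_; yes; no)
open import Relation.Binary.PropositionalEquality using (_≡_)
open import Relation.Binary.Structures using (IsTotalOrder)
open import Algebra.Bundles using (CommutativeRing)

-- A (linearly) ordered field.  The theorem is stated for every ordered
-- field; ℝ is an instance, so this covers the paper's ℝ^n statement.
record OrderedField (c ℓ₁ ℓ₂ : Level) : Set (lsuc (c ⊔ ℓ₁ ⊔ ℓ₂)) where
  infix 4 _≤_
  infix 8 _⁻¹
  field
    commutativeRing : CommutativeRing c ℓ₁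
  open CommutativeRing commutativeRing public
  field
    _≤_          : Carrier → Carrier → Set ℓ₂
    isTotalOrder : IsTotalOrder _≈_ _≤_
    +-monoˡ-≤    : ∀ {x y} z → x ≤ y → x + z ≤ y + z
    *-nonneg     : ∀ {x y} → 0# ≤ x → 0# ≤ y → 0# ≤ x * y
    0≉1          : ¬ (0# ≈ 1#)
    _⁻¹          : Carrier → Carrier
    ⁻¹-inverse   : ∀ x → ¬ (x ≈ 0#) → x * (x ⁻¹) ≈ 1#

module _ {c ℓ₁ ℓ₂} (F : OrderedField c ℓ₁ ℓ₂) where
  open OrderedField F

  -- vectors in F^n, indexed 0,...,n-1 (index k stands for the paper's k+1)
  Vector : ℕ → Set c
  Vector n = Fin n → Carrier

  _≈ᵛ_ : ∀ {n} → Vector n → Vector n → Set ℓ₁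
  a ≈ᵛ b = ∀ i → a i ≈ b i

  ι : ℕ → Carrier
  ι zero    = 0#
  ι (suc m) = 1# + ι m

  Positive : ∀ {n} → Vector n → Set ℓ₂
  Positive a = ∀ i → 0# ≤ a i

  Convex : ∀ {n} → Vector n → Set (ℓ₂)
  Convex {n} a = ∀ (k l m : Fin n) → toℕ l ≡ suc (toℕ k) → toℕ m ≡ suc (toℕ l) →
                 0# ≤ (a m - (a l + a l)) + a k

  Concave : ∀ {n} → Vector n → Set ℓ₂
  Concave a = Convex (λ i → - a i)

  -- the minimal standard concave vectors: c⁽ⁱ⁾ = minc n i (0-based i, j)
  --  j ≤ i, i ≠ 0 : j / i          (paper: (j-1)/(i-1))
  --  j ≤ i, i = 0 : 1              (then j = i)
  --  j > i        : (n-1-j)/(n-1-i) (paper: (n-j)/(n-i))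
  minc : (n : ℕ) → Fin n → Vector n
  minc n i j with toℕ j ≤? toℕ i
  ... | yes _ with toℕ i ≟ 0
  ...   | yes _ = 1#
  ...   | no  _ = ι (toℕ j) * (ι (toℕ i)) ⁻¹
  minc n i j | no _ = ι (n ∸ 1 ∸ toℕ j) * (ι (n ∸ 1 ∸ toℕ i)) ⁻¹

  ∑ : ∀ {n} → (Fin n → Carrier) → Carrier
  ∑ {zero}  f = 0#
  ∑ {suc n} f = f fzero + ∑ (λ i → f (fsuc i))

  lincomb : ∀ {n} → (Fin n → Vector n) → Vector n → Vector n
  lincomb v lam j = ∑ (λ i → lam i * v i j)

  IsBasis : ∀ {n} → (Fin n → Vector n) → Set (c ⊔ ℓ₁)
  IsBasis {n} v = ∀ (x : Vector n) →
    Σ (Vector n) λ lam → (x ≈ᵛ lincomb v lam) ×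
      (∀ (mu : Vector n) → x ≈ᵛ lincomb v mu → lam ≈ᵛ mu)

module Submission where

open import Defs
open import Level using (Level)
open import Data.Nat using (ℕ; _≤_)
open import Data.Product using (Σ; _×_)
open import Data.Nat using (_∸_)
import Data.Nat as ℕ
import Data.Nat.Properties as ℕP
open import Data.Fin using (Fin; toℕ; fromℕ; fromℕ<) renaming (zero to fzero; suc to fsuc)
import Data.Fin.Properties as FinP
open import Data.Product using (_,_)
open import Data.Sum using (inj₁; inj₂)
open import Data.Empty using (⊥-elim)
open import Relation.Nullary using (¬_; yes; no)
import Relation.Binary.PropositionalEquality as ≡
open ≡ using (_≡_; _≢_)
open import Relation.Binary.Structures using (IsTotalOrder)
import Algebra.Properties.Ring as RingProperties
import Algebra.Solver.Ring.NaturalCoefficients.Default as NaturalSolver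
import Relation.Binary.Reasoning.Setoid as SetoidReasoning

-- Write n = N + 1 and view vectors of Fⁿ as sequences on [0, N].  The
-- minimal standard concave vector with peak a is the "tent" rising linearly
-- from 0 at 0 to 1 at a and falling linearly to 0 at N.  Its second
-- differences Δ² vanish everywhere except at the peak, where for an interior
-- peak a = k + 1 the second difference is -N / (a (N - a)) < 0.  Hence a
-- combination ∑ λᵢ tentᵢ has value λ₀ at 0, value λ_N at N, and second
-- difference at k equal to λ_(k+1) times that kink.  This suggests reading off
-- coordinates from a vector x: x₀, x_N, and -Δ² x k · a(N-a)/N inside.
--   * Uniqueness: applied to a combination, this recovers its coefficients.
--   * Existence: the combination with these coordinates has the same end
--     values and second differences as x, and a sequence vanishing at both
--     ends with zero second differences vanishes (discrete boundary value
--     problem), so it equals x.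
--   * Positivity: for x positive and concave, x₀, x_N ≥ 0 and -Δ² x ≥ 0.
-- The file develops ordered-field facts, finite sums, the second difference,
-- the boundary value problem, the tent vectors and the coordinates, in order.

module OrderedFieldLemmas {c ℓ₁ ℓ₂} (F : OrderedField c ℓ₁ ℓ₂) where
  open OrderedField F renaming (_≤_ to _≤ᶠ_)
  open IsTotalOrder isTotalOrder using (antisym; total; ≲-respˡ-≈; ≲-respʳ-≈)
    renaming (refl to ≤-refl; trans to ≤-trans)
  open RingProperties ring using (-‿distribˡ-*; -‿distribʳ-*; -‿involutive)

  ιF : ℕ → Carrier
  ιF = ι F

  ≤-resp : ∀ {a b a′ b′} → a ≈ a′ → b ≈ b′ → a ≤ᶠ b → a′ ≤ᶠ b′
  ≤-resp a≈a′ b≈b′ a≤b = ≲-respˡ-≈ a≈a′ (≲-respʳ-≈ b≈b′ a≤b)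

  +-mono-≤ : ∀ {a b c d} → a ≤ᶠ b → c ≤ᶠ d → a + c ≤ᶠ b + d
  +-mono-≤ {a} {b} {c} {d} a≤b c≤d =
    ≤-trans (+-monoˡ-≤ c a≤b) (≤-resp (+-comm c b) (+-comm d b) (+-monoˡ-≤ b c≤d))

  neg-nonneg : ∀ {x} → x ≤ᶠ 0# → 0# ≤ᶠ - x
  neg-nonneg {x} x≤0 = ≤-resp (-‿inverseʳ x) (+-identityˡ (- x)) (+-monoˡ-≤ (- x) x≤0)

  square-nonneg : ∀ x → 0# ≤ᶠ x * x
  square-nonneg x with total 0# x
  ... | inj₁ 0≤x = *-nonneg 0≤x 0≤x
  ... | inj₂ x≤0 = ≤-resp refl (-x*-x≈x*x) (*-nonneg (neg-nonneg x≤0) (neg-nonneg x≤0))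
    where
    -x*-x≈x*x : - x * - x ≈ x * x
    -x*-x≈x*x = trans (sym (-‿distribˡ-* x (- x)))
                  (trans (-‿cong (sym (-‿distribʳ-* x x))) (-‿involutive (x * x)))

  0≤1 : 0# ≤ᶠ 1#
  0≤1 = ≤-resp refl (*-identityˡ 1#) (square-nonneg 1#)

  1≰0 : ¬ (1# ≤ᶠ 0#)
  1≰0 1≤0 = 0≉1 (antisym 0≤1 1≤0)

  ι-nonneg : ∀ m → 0# ≤ᶠ ιF m
  ι-nonneg ℕ.zero    = ≤-refl
  ι-nonneg (ℕ.suc m) = ≤-resp (+-identityˡ 0#) refl (+-mono-≤ 0≤1 (ι-nonneg m))

  ι≉0 : ∀ {m} → m ≢ 0 → ¬ (ιF m ≈ 0#)
  ι≉0 {ℕ.zero}  m≢0 _   = m≢0 ≡.refl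
  ι≉0 {ℕ.suc m} _   ι≈0 = 1≰0 (≤-resp (+-identityʳ 1#) ι≈0 (+-mono-≤ ≤-refl (ι-nonneg m)))

  ι-+ : ∀ m k → ιF (m ℕ.+ k) ≈ ιF m + ιF k
  ι-+ ℕ.zero    k = sym (+-identityˡ (ιF k))
  ι-+ (ℕ.suc m) k = trans (+-cong refl (ι-+ m k)) (sym (+-assoc 1# (ιF m) (ιF k)))

  inverse-nonneg : ∀ {x} → 0# ≤ᶠ x → ¬ (x ≈ 0#) → 0# ≤ᶠ x ⁻¹
  inverse-nonneg {x} 0≤x x≉0 with total 0# (x ⁻¹)
  ... | inj₁ 0≤x⁻¹ = 0≤x⁻¹
  ... | inj₂ x⁻¹≤0 = ⊥-elim (1≰0 (≤-resp (+-identityˡ 1#) (-‿inverseˡ 1#) (+-monoˡ-≤ 1# 0≤-1)))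
    where
    0≤-1 : 0# ≤ᶠ - 1#
    0≤-1 = ≤-resp refl (trans (sym (-‿distribʳ-* x (x ⁻¹))) (-‿cong (⁻¹-inverse x x≉0)))
                  (*-nonneg 0≤x (neg-nonneg x⁻¹≤0))

  divide-multiply : ∀ {a b} → ¬ (b ≈ 0#) → (a * b ⁻¹) * b ≈ a
  divide-multiply {a} {b} b≉0 =
    trans (*-assoc a (b ⁻¹) b)
      (trans (*-cong refl (trans (*-comm (b ⁻¹) b) (⁻¹-inverse b b≉0))) (*-identityʳ a))

  *-cancel-≉0 : ∀ {x b} → ¬ (b ≈ 0#) → x * b ≈ 0# → x ≈ 0#
  *-cancel-≉0 {x} {b} b≉0 xb≈0 = begin
    x                  ≈⟨ sym (*-identityʳ x) ⟩
    x * 1#             ≈⟨ *-cong refl (sym (⁻¹-inverse b b≉0)) ⟩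
    x * (b * b ⁻¹)     ≈⟨ sym (*-assoc x b (b ⁻¹)) ⟩
    (x * b) * b ⁻¹     ≈⟨ *-cong xb≈0 refl ⟩
    0# * b ⁻¹          ≈⟨ zeroˡ (b ⁻¹) ⟩
    0#                 ∎
    where open SetoidReasoning setoid

module FiniteSums {c ℓ₁ ℓ₂} (F : OrderedField c ℓ₁ ℓ₂) where
  open OrderedField F hiding (_≤_)

  ∑-cong : ∀ {n} {f g : Fin n → Carrier} → (∀ i → f i ≈ g i) → ∑ F f ≈ ∑ F g
  ∑-cong {ℕ.zero}  f≈g = refl
  ∑-cong {ℕ.suc n} f≈g = +-cong (f≈g fzero) (∑-cong (λ i → f≈g (fsuc i)))

  ∑-zero : ∀ {n} (f : Fin n → Carrier) → (∀ i → f i ≈ 0#) → ∑ F f ≈ 0#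
  ∑-zero {ℕ.zero}  f f≈0 = refl
  ∑-zero {ℕ.suc n} f f≈0 =
    trans (+-cong (f≈0 fzero) (∑-zero (λ i → f (fsuc i)) (λ i → f≈0 (fsuc i)))) (+-identityˡ 0#)

  ∑-single : ∀ {n} (f : Fin n → Carrier) (i : Fin n) →
             (∀ j → toℕ j ≢ toℕ i → f j ≈ 0#) → ∑ F f ≈ f i
  ∑-single {ℕ.suc n} f fzero    off =
    trans (+-cong refl (∑-zero _ (λ j → off (fsuc j) (λ ())))) (+-identityʳ (f fzero))
  ∑-single {ℕ.suc n} f (fsuc i) off =
    trans (+-cong (off fzero (λ ())) (∑-single (λ j → f (fsuc j)) i off′)) (+-identityˡ (f (fsuc i)))
    where
    off′ : ∀ j → toℕ j ≢ toℕ i → f (fsuc j) ≈ 0#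
    off′ j j≢i = off (fsuc j) (λ e → j≢i (ℕP.suc-injective e))

module SecondDifference {c ℓ₁ ℓ₂} (F : OrderedField c ℓ₁ ℓ₂) where
  open OrderedField F hiding (_≤_)
  open OrderedFieldLemmas F using (ιF)
  open RingProperties ring using (-‿+-comm; -‿distribˡ-*; -0#≈0#)
  open NaturalSolver commutativeSemiring using (solve; _:=_; _:+_; con)
  open SetoidReasoning setoid

  δ² : Carrier → Carrier → Carrier → Carrier
  δ² a b c = (c - (b + b)) + a

  Δ² : (ℕ → Carrier) → ℕ → Carrier
  Δ² y k = δ² (y k) (y (ℕ.suc k)) (y (ℕ.suc (ℕ.suc k)))

  δ²-cong : ∀ {a a′ b b′ c c′} → a ≈ a′ → b ≈ b′ → c ≈ c′ → δ² a b c ≈ δ² a′ b′ c′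
  δ²-cong a≈a′ b≈b′ c≈c′ = +-cong (+-cong c≈c′ (-‿cong (+-cong b≈b′ b≈b′))) a≈a′

  δ²-split : ∀ a b c → δ² a b c ≈ (c + a) - (b + b)
  δ²-split a b c = solve 3 (λ a d c → (c :+ d) :+ a := (c :+ a) :+ d) refl a (- (b + b)) c

  δ²-value : ∀ {a b c z} → (c + a) + z ≈ b + b → δ² a b c ≈ - z
  δ²-value {a} {b} {c} {z} eq = begin
    δ² a b c                         ≈⟨ δ²-split a b c ⟩
    (c + a) - (b + b)                ≈⟨ +-cong refl (-‿cong (sym eq)) ⟩
    (c + a) - ((c + a) + z)          ≈⟨ +-cong refl (sym (-‿+-comm (c + a) z)) ⟩
    (c + a) + (- (c + a) + - z)      ≈⟨ sym (+-assoc (c + a) (- (c + a)) (- z)) ⟩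
    ((c + a) - (c + a)) + - z        ≈⟨ +-cong (-‿inverseʳ (c + a)) refl ⟩
    0# + - z                         ≈⟨ +-identityˡ (- z) ⟩
    - z                              ∎

  δ²-zero : ∀ {a b c} → c + a ≈ b + b → δ² a b c ≈ 0#
  δ²-zero {a} {b} {c} eq = trans (δ²-value (trans (+-identityʳ (c + a)) eq)) -0#≈0#

  δ²-zero⇒ : ∀ {a b c} → δ² a b c ≈ 0# → c + a ≈ b + b
  δ²-zero⇒ {a} {b} {c} δ²≈0 = begin
    c + a                            ≈⟨ sym (+-identityʳ (c + a)) ⟩
    (c + a) + 0#                     ≈⟨ +-cong refl (sym (-‿inverseˡ (b + b))) ⟩
    (c + a) + (- (b + b) + (b + b))  ≈⟨ sym (+-assoc (c + a) (- (b + b)) (b + b)) ⟩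
    ((c + a) - (b + b)) + (b + b)    ≈⟨ +-cong (trans (sym (δ²-split a b c)) δ²≈0) refl ⟩
    0# + (b + b)                     ≈⟨ +-identityˡ (b + b) ⟩
    b + b                            ∎

  δ²-+ : ∀ a b c a′ b′ c′ → δ² (a + a′) (b + b′) (c + c′) ≈ δ² a b c + δ² a′ b′ c′
  δ²-+ a b c a′ b′ c′ = begin
    ((c + c′) - ((b + b′) + (b + b′))) + (a + a′)
      ≈⟨ +-cong (+-cong refl (trans (sym (-‿+-comm (b + b′) (b + b′)))
                  (+-cong (sym (-‿+-comm b b′)) (sym (-‿+-comm b b′))))) refl ⟩
    ((c + c′) + ((- b + - b′) + (- b + - b′))) + (a + a′)
      ≈⟨ solve 6 (λ a b c a′ b′ c′ → ((c :+ c′) :+ ((b :+ b′) :+ (b :+ b′))) :+ (a :+ a′)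
                    := ((c :+ (b :+ b)) :+ a) :+ ((c′ :+ (b′ :+ b′)) :+ a′)) refl a (- b) c a′ (- b′) c′ ⟩
    ((c + (- b + - b)) + a) + ((c′ + (- b′ + - b′)) + a′)
      ≈⟨ +-cong (+-cong (+-cong refl (-‿+-comm b b)) refl) (+-cong (+-cong refl (-‿+-comm b′ b′)) refl) ⟩
    δ² a b c + δ² a′ b′ c′ ∎

  δ²-neg : ∀ a b c → δ² (- a) (- b) (- c) ≈ - δ² a b c
  δ²-neg a b c = begin
    (- c - (- b + - b)) + - a        ≈⟨ +-cong (+-cong refl (-‿cong (-‿+-comm b b))) refl ⟩
    (- c + - - (b + b)) + - a        ≈⟨ +-cong (-‿+-comm c (- (b + b))) refl ⟩
    - (c - (b + b)) + - a            ≈⟨ -‿+-comm (c - (b + b)) a ⟩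
    - ((c - (b + b)) + a)            ∎

  δ²-- : ∀ a b c a′ b′ c′ → δ² (a - a′) (b - b′) (c - c′) ≈ δ² a b c - δ² a′ b′ c′
  δ²-- a b c a′ b′ c′ = trans (δ²-+ a b c (- a′) (- b′) (- c′)) (+-cong refl (δ²-neg a′ b′ c′))

  δ²-*ʳ : ∀ a b c l → δ² (a * l) (b * l) (c * l) ≈ δ² a b c * l
  δ²-*ʳ a b c l = sym (begin
    ((c - (b + b)) + a) * l              ≈⟨ distribʳ l (c - (b + b)) a ⟩
    (c - (b + b)) * l + a * l            ≈⟨ +-cong (distribʳ l c (- (b + b))) refl ⟩
    (c * l + - (b + b) * l) + a * l      ≈⟨ +-cong (+-cong refl (sym (-‿distribˡ-* (b + b) l))) refl ⟩
    (c * l - (b + b) * l) + a * l        ≈⟨ +-cong (+-cong refl (-‿cong (distribʳ l b b))) refl ⟩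
    (c * l - (b * l + b * l)) + a * l    ∎)

  δ²-*ˡ : ∀ l a b c → δ² (l * a) (l * b) (l * c) ≈ l * δ² a b c
  δ²-*ˡ l a b c = trans (δ²-cong (*-comm l a) (*-comm l b) (*-comm l c))
                        (trans (δ²-*ʳ a b c l) (*-comm (δ² a b c) l))

  δ²-∑ : ∀ {n} (f g h : Fin n → Carrier) → δ² (∑ F f) (∑ F g) (∑ F h) ≈ ∑ F (λ i → δ² (f i) (g i) (h i))
  δ²-∑ {ℕ.zero}  f g h = δ²-zero refl
  δ²-∑ {ℕ.suc n} f g h = trans (δ²-+ _ _ _ _ _ _)
    (+-cong refl (δ²-∑ (λ i → f (fsuc i)) (λ i → g (fsuc i)) (λ i → h (fsuc i))))

  δ²-ι : ∀ m → δ² (ιF m) (ιF (ℕ.suc m)) (ιF (ℕ.suc (ℕ.suc m))) ≈ 0#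
  δ²-ι m = δ²-zero (solve 1 (λ x → (con 1 :+ (con 1 :+ x)) :+ x := (con 1 :+ x) :+ (con 1 :+ x)) refl (ιF m))

  δ²-ι-reversed : ∀ m → δ² (ιF (ℕ.suc (ℕ.suc m))) (ιF (ℕ.suc m)) (ιF m) ≈ 0#
  δ²-ι-reversed m = δ²-zero (solve 1 (λ x → x :+ (con 1 :+ (con 1 :+ x)) := (con 1 :+ x) :+ (con 1 :+ x)) refl (ιF m))

module BoundaryValueProblem {c ℓ₁ ℓ₂} (F : OrderedField c ℓ₁ ℓ₂) where
  open OrderedField F hiding (_≤_)
  open OrderedFieldLemmas F using (ιF; ι≉0; *-cancel-≉0)
  open SecondDifference F using (Δ²; δ²-zero⇒; δ²--)
  open RingProperties ring using (+-cancelʳ)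
  open NaturalSolver commutativeSemiring using (solve; _:=_; _:+_; _:*_; con)
  open SetoidReasoning setoid

  Δ²-vanishes : ℕ → (ℕ → Carrier) → Set ℓ₁
  Δ²-vanishes N h = ∀ k → 2 ℕ.+ k ≤ N → Δ² h k ≈ 0#

  arithmetic : ∀ {N h} → h 0 ≈ 0# → Δ²-vanishes N h → ∀ m → m ≤ N → h m ≈ ιF m * h 1
  arithmetic {N} {h} h0≈0 flat = go
    where
    go : ∀ m → m ≤ N → h m ≈ ιF m * h 1
    go 0 _ = trans h0≈0 (sym (zeroˡ (h 1)))
    go 1 _ = sym (trans (*-cong (+-identityʳ 1#) refl) (*-identityˡ (h 1)))
    go (ℕ.suc (ℕ.suc k)) k+2≤N = +-cancelʳ (h k) (h (2 ℕ.+ k)) (ιF (2 ℕ.+ k) * h 1) (begin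
      h (2 ℕ.+ k) + h k              ≈⟨ δ²-zero⇒ (flat k k+2≤N) ⟩
      h (1 ℕ.+ k) + h (1 ℕ.+ k)      ≈⟨ +-cong (go (ℕ.suc k) k+1≤N) (go (ℕ.suc k) k+1≤N) ⟩
      ιF (1 ℕ.+ k) * h 1 + ιF (1 ℕ.+ k) * h 1
        ≈⟨ solve 2 (λ x y → (con 1 :+ x) :* y :+ (con 1 :+ x) :* y
                            := (con 1 :+ (con 1 :+ x)) :* y :+ x :* y) refl (ιF k) (h 1) ⟩
      ιF (2 ℕ.+ k) * h 1 + ιF k * h 1  ≈⟨ +-cong refl (sym (go k (ℕP.≤-trans (ℕP.n≤1+n k) k+1≤N))) ⟩
      ιF (2 ℕ.+ k) * h 1 + h k       ∎)
      where
      k+1≤N : 1 ℕ.+ k ≤ N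
      k+1≤N = ℕP.≤-trans (ℕP.n≤1+n (1 ℕ.+ k)) k+2≤N

  vanishes : ∀ {N h} → h 0 ≈ 0# → h N ≈ 0# → Δ²-vanishes N h → ∀ m → m ≤ N → h m ≈ 0#
  vanishes {ℕ.zero}  h0≈0 _    _    .0 ℕ.z≤n = h0≈0
  vanishes {ℕ.suc N} {h} h0≈0 hN≈0 flat m m≤N = begin
    h m             ≈⟨ arithmetic h0≈0 flat m m≤N ⟩
    ιF m * h 1      ≈⟨ *-cong refl h1≈0 ⟩
    ιF m * 0#       ≈⟨ zeroʳ (ιF m) ⟩
    0#              ∎
    where
    h1≈0 : h 1 ≈ 0#
    h1≈0 = *-cancel-≉0 (ι≉0 {ℕ.suc N} (λ ())) (trans (*-comm (h 1) _)
             (trans (sym (arithmetic h0≈0 flat (ℕ.suc N) ℕP.≤-refl)) hN≈0))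

  -- apply vanishes to the difference f - g
  determined : ∀ {N} (f g : ℕ → Carrier) → f 0 ≈ g 0 → f N ≈ g N →
               (∀ k → 2 ℕ.+ k ≤ N → Δ² f k ≈ Δ² g k) → ∀ m → m ≤ N → f m ≈ g m
  determined f g f0≈g0 fN≈gN Δ²f≈Δ²g m m≤N =
    difference-zero (vanishes (zero-difference f0≈g0) (zero-difference fN≈gN)
      (λ k k+2≤N → trans (δ²-- _ _ _ _ _ _) (zero-difference (Δ²f≈Δ²g k k+2≤N))) m m≤N)
    where
    zero-difference : ∀ {x y} → x ≈ y → x - y ≈ 0#
    zero-difference {x} {y} x≈y = trans (+-cong x≈y refl) (-‿inverseʳ y)
    difference-zero : ∀ {x y} → x - y ≈ 0# → x ≈ y
    difference-zero {x} {y} x-y≈0 = +-cancelʳ (- y) x y (trans x-y≈0 (sym (-‿inverseʳ y)))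

module MinimalConcaveVectors {c ℓ₁ ℓ₂} (F : OrderedField c ℓ₁ ℓ₂) (N : ℕ) where
  open OrderedField F renaming (_≤_ to _≤ᶠ_)
  open OrderedFieldLemmas F
    using (ιF; ι≉0; ι-+; ι-nonneg; inverse-nonneg; divide-multiply; *-cancel-≉0)
  open SecondDifference F
  open NaturalSolver commutativeSemiring using (solve; _:=_; _:+_; _:*_; con)
  open SetoidReasoning setoid

  tent : ℕ → ℕ → Carrier
  tent a m with m ℕ.≤? a
  ... | yes _ with a ℕ.≟ 0
  ...   | yes _ = 1#
  ...   | no  _ = ιF m * ιF a ⁻¹
  tent a m | no _ = ιF (N ∸ m) * ιF (N ∸ a) ⁻¹

  minc≡tent : (i j : Fin (ℕ.suc N)) → minc F (ℕ.suc N) i j ≡ tent (toℕ i) (toℕ j)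
  minc≡tent i j with toℕ j ℕ.≤? toℕ i
  ... | yes _ with toℕ i ℕ.≟ 0
  ...   | yes _ = ≡.refl
  ...   | no  _ = ≡.refl
  minc≡tent i j | no _ = ≡.refl

  private
    N∸≢0 : ∀ {a} → a ℕ.< N → N ∸ a ≢ 0
    N∸≢0 a<N = ℕP.m>n⇒m∸n≢0 a<N

    N∸-step : ∀ {m} → ℕ.suc m ≤ N → N ∸ m ≡ ℕ.suc (N ∸ ℕ.suc m)
    N∸-step {m} m<N = ≡.trans (≡.sym (ℕP.suc-pred (N ∸ m) {{ℕ.≢-nonZero (N∸≢0 m<N)}}))
                              (≡.cong ℕ.suc (ℕP.pred[m∸n]≡m∸[1+n] N m))

  tent-rising : ∀ {a m} → m ≤ a → a ≢ 0 → tent a m * ιF a ≈ ιF m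
  tent-rising {a} {m} m≤a a≢0 with m ℕ.≤? a
  ... | no m≰a = ⊥-elim (m≰a m≤a)
  ... | yes _ with a ℕ.≟ 0
  ...   | yes a≡0 = ⊥-elim (a≢0 a≡0)
  ...   | no  _   = divide-multiply (ι≉0 a≢0)

  tent-falling : ∀ {a m} → a ≤ m → a ℕ.< N → tent a m * ιF (N ∸ a) ≈ ιF (N ∸ m)
  tent-falling {a} {m} a≤m a<N with m ℕ.≤? a
  ... | no _ = divide-multiply (ι≉0 (N∸≢0 a<N))
  ... | yes m≤a with ℕP.≤-antisym m≤a a≤m
  ...   | ≡.refl with a ℕ.≟ 0
  ...     | yes _ = *-identityˡ _
  ...     | no a≢0 = trans (*-cong (⁻¹-inverse _ (ι≉0 a≢0)) refl) (*-identityˡ _)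

  tent-peak : ∀ a → tent a a ≈ 1#
  tent-peak a with a ℕ.≤? a
  ... | no a≰a = ⊥-elim (a≰a ℕP.≤-refl)
  ... | yes _ with a ℕ.≟ 0
  ...   | yes _  = refl
  ...   | no a≢0 = ⁻¹-inverse _ (ι≉0 a≢0)

  tent-at-0 : ∀ {a} → a ≢ 0 → tent a 0 ≈ 0#
  tent-at-0 a≢0 = *-cancel-≉0 (ι≉0 a≢0) (tent-rising ℕ.z≤n a≢0)

  tent-at-N : ∀ {a} → a ℕ.< N → tent a N ≈ 0#
  tent-at-N {a} a<N = *-cancel-≉0 (ι≉0 (N∸≢0 a<N))
    (trans (tent-falling (ℕP.<⇒≤ a<N) a<N) (reflexive (≡.cong ιF (ℕP.n∸n≡0 N))))

  Δ²-tent-flat : ∀ {a k} → 2 ℕ.+ k ≤ N → a ≢ ℕ.suc k → Δ² (tent a) k ≈ 0#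
  Δ²-tent-flat {a} {k} k+2≤N a≢k+1 with a ℕ.≤? k
  ... | yes a≤k = *-cancel-≉0 (ι≉0 (N∸≢0 a<N)) (begin
    Δ² (tent a) k * s                                    ≈⟨ sym (δ²-*ʳ _ _ _ s) ⟩
    δ² (tent a k * s) (tent a (1 ℕ.+ k) * s) (tent a (2 ℕ.+ k) * s)
      ≈⟨ δ²-cong (falling a≤k (≡.trans (N∸-step k<N) (≡.cong ℕ.suc (N∸-step k+2≤N))))
                 (falling (ℕP.m≤n⇒m≤1+n a≤k) (N∸-step k+2≤N))
                 (falling (ℕP.m≤n⇒m≤1+n (ℕP.m≤n⇒m≤1+n a≤k)) ≡.refl) ⟩
    δ² (ιF (2 ℕ.+ q)) (ιF (1 ℕ.+ q)) (ιF q)              ≈⟨ δ²-ι-reversed q ⟩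
    0#                                                   ∎)
    where
    s = ιF (N ∸ a)
    q = N ∸ (2 ℕ.+ k)
    k<N : k ℕ.< N
    k<N = ℕP.≤-trans (ℕP.n≤1+n (ℕ.suc k)) k+2≤N
    a<N : a ℕ.< N
    a<N = ℕP.≤-<-trans a≤k k<N
    falling : ∀ {m r} → a ≤ m → N ∸ m ≡ r → tent a m * s ≈ ιF r
    falling a≤m ≡.refl = tent-falling a≤m a<N
  ... | no a≰k = *-cancel-≉0 (ι≉0 a≢0) (begin
    Δ² (tent a) k * ιF a                                 ≈⟨ sym (δ²-*ʳ _ _ _ (ιF a)) ⟩
    δ² (tent a k * ιF a) (tent a (1 ℕ.+ k) * ιF a) (tent a (2 ℕ.+ k) * ιF a)
      ≈⟨ δ²-cong (tent-rising (ℕP.<⇒≤ k+1≤a) a≢0) (tent-rising k+1≤a a≢0) (tent-rising k+2≤a a≢0) ⟩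
    δ² (ιF k) (ιF (1 ℕ.+ k)) (ιF (2 ℕ.+ k))              ≈⟨ δ²-ι k ⟩
    0#                                                   ∎)
    where
    k+1≤a : ℕ.suc k ≤ a
    k+1≤a = ℕP.≰⇒> a≰k
    k+2≤a : 2 ℕ.+ k ≤ a
    k+2≤a = ℕP.≤∧≢⇒< k+1≤a (λ k+1≡a → a≢k+1 (≡.sym k+1≡a))
    a≢0 : a ≢ 0
    a≢0 = ℕP.m<n⇒n≢0 k+2≤a

  -- the reciprocal curvature of the kink: (k+1)(N-k-1)/N
  weight : ℕ → Carrier
  weight k = (ιF (ℕ.suc k) * ιF (N ∸ ℕ.suc k)) * ιF N ⁻¹

  weight-nonneg : ∀ k → N ≢ 0 → 0# ≤ᶠ weight k
  weight-nonneg k N≢0 = *-nonneg (*-nonneg (ι-nonneg (ℕ.suc k)) (ι-nonneg (N ∸ ℕ.suc k)))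
                                 (inverse-nonneg (ι-nonneg N) (ι≉0 N≢0))

  Δ²-tent-kink-scaled : ∀ {k} → 2 ℕ.+ k ≤ N →
    Δ² (tent (ℕ.suc k)) k * (ιF (ℕ.suc k) * ιF (N ∸ ℕ.suc k)) ≈ - ιF N
  Δ²-tent-kink-scaled {k} k+2≤N = begin
    Δ² (tent a) k * (A * B)                        ≈⟨ sym (δ²-*ʳ _ _ _ (A * B)) ⟩
    δ² (tent a k * (A * B)) (tent a a * (A * B)) (tent a (ℕ.suc a) * (A * B))
                                                   ≈⟨ δ²-cong left middle right ⟩
    δ² (ιF k * B) (A * B) (ιF q * A)               ≈⟨ δ²-value (at-B (kink-identity (ιF k) (ιF q))) ⟩
    - (A + B)                                      ≈⟨ -‿cong A+B≈N ⟩
    - ιF N                                         ∎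
    where
    a = ℕ.suc k
    q = N ∸ (2 ℕ.+ k)
    A = ιF a
    B = ιF (N ∸ a)
    left : tent a k * (A * B) ≈ ιF k * B
    left = trans (sym (*-assoc _ A B)) (*-cong (tent-rising (ℕP.n≤1+n k) (λ ())) refl)
    middle : tent a a * (A * B) ≈ A * B
    middle = trans (*-cong (tent-peak a) refl) (*-identityˡ (A * B))
    right : tent a (ℕ.suc a) * (A * B) ≈ ιF q * A
    right = trans (*-cong refl (*-comm A B)) (trans (sym (*-assoc _ B A))
              (*-cong (tent-falling (ℕP.n≤1+n a) k+2≤N) refl))
    -- with A = 1 + x and B = 1 + y: (y A + x B) + (A + B) = 2 A B
    kink-identity : ∀ x y → (y * (1# + x) + x * (1# + y)) + ((1# + x) + (1# + y))
                              ≈ (1# + x) * (1# + y) + (1# + x) * (1# + y)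
    kink-identity = solve 2 (λ x y → (y :* (con 1 :+ x) :+ x :* (con 1 :+ y)) :+ ((con 1 :+ x) :+ (con 1 :+ y))
                                    := (con 1 :+ x) :* (con 1 :+ y) :+ (con 1 :+ x) :* (con 1 :+ y)) refl
    at-B : (ιF q * A + ιF k * ιF (ℕ.suc q)) + (A + ιF (ℕ.suc q)) ≈ A * ιF (ℕ.suc q) + A * ιF (ℕ.suc q) →
           (ιF q * A + ιF k * B) + (A + B) ≈ A * B + A * B
    at-B eq rewrite N∸-step k+2≤N = eq
    A+B≈N : A + B ≈ ιF N
    A+B≈N = trans (sym (ι-+ a (N ∸ a))) (reflexive (≡.cong ιF (ℕP.m+[n∸m]≡n (ℕP.<⇒≤ k+2≤N))))

  Δ²-tent-kink : ∀ {k} → 2 ℕ.+ k ≤ N → Δ² (tent (ℕ.suc k)) k * weight k ≈ - 1#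
  Δ²-tent-kink {k} k+2≤N = begin
    Δ² (tent a) k * (AB * ιF N ⁻¹)    ≈⟨ sym (*-assoc _ AB _) ⟩
    (Δ² (tent a) k * AB) * ιF N ⁻¹    ≈⟨ *-cong (Δ²-tent-kink-scaled k+2≤N) refl ⟩
    - ιF N * ιF N ⁻¹                  ≈⟨ sym (-‿distribˡ-* (ιF N) _) ⟩
    - (ιF N * ιF N ⁻¹)                ≈⟨ -‿cong (⁻¹-inverse (ιF N) (ι≉0 (ℕP.m<n⇒n≢0 k+2≤N))) ⟩
    - 1#                              ∎
    where
    open RingProperties ring using (-‿distribˡ-*)
    a = ℕ.suc k
    AB = ιF a * ιF (N ∸ a)

-- Extending a vector indexed by Fin n to a sequence on ℕ (by a default value
-- outside [0, n)), so that second differences can be taken on ℕ.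
module Extension {a} {A : Set a} (default : A) where

  extend : ∀ {n} → (Fin n → A) → ℕ → A
  extend {n} x m with m ℕ.<? n
  ... | yes m<n = x (fromℕ< m<n)
  ... | no  _   = default

  extend-fromℕ< : ∀ {n} (x : Fin n → A) {m} (m<n : m ℕ.< n) → extend x m ≡ x (fromℕ< m<n)
  extend-fromℕ< {n} x {m} m<n with m ℕ.<? n
  ... | yes _   = ≡.refl
  ... | no  m≮n = ⊥-elim (m≮n m<n)

  extend-toℕ : ∀ {n} (x : Fin n → A) (i : Fin n) → extend x (toℕ i) ≡ x i
  extend-toℕ x i = ≡.trans (extend-fromℕ< x (FinP.toℕ<n i)) (≡.cong x (FinP.fromℕ<-toℕ i _))

module Coordinates {c ℓ₁ ℓ₂} (F : OrderedField c ℓ₁ ℓ₂) (N : ℕ) where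
  open OrderedField F renaming (_≤_ to _≤ᶠ_)
  open OrderedFieldLemmas F using (≤-resp)
  open FiniteSums F
  open SecondDifference F
  open BoundaryValueProblem F using (determined)
  open MinimalConcaveVectors F N
  open Extension 0#
  open RingProperties ring using (-‿distribˡ-*; -‿distribʳ-*; -‿involutive)
  open SetoidReasoning setoid

  V : Set c
  V = Vector F (ℕ.suc N)

  combination : V → ℕ → Carrier
  combination lam m = ∑ F (λ i → lam i * tent (toℕ i) m)

  lincomb≈combination : ∀ lam j → lincomb F (minc F (ℕ.suc N)) lam j ≈ combination lam (toℕ j)
  lincomb≈combination lam j =
    ∑-cong {g = λ i → lam i * tent (toℕ i) (toℕ j)} (λ i → *-cong refl (reflexive (minc≡tent i j)))

  combination-single : ∀ lam m (i : Fin (ℕ.suc N)) →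
    (∀ (j : Fin (ℕ.suc N)) → toℕ j ≢ toℕ i → tent (toℕ j) m ≈ 0#) →
    combination lam m ≈ lam i * tent (toℕ i) m
  combination-single lam m i off =
    ∑-single _ i (λ j j≢i → trans (*-cong refl (off j j≢i)) (zeroʳ (lam j)))

  combination-at-0 : ∀ lam (i : Fin (ℕ.suc N)) → toℕ i ≡ 0 → combination lam 0 ≈ lam i
  combination-at-0 lam i i≡0 =
    trans (combination-single lam 0 i (λ j j≢i → tent-at-0 (λ j≡0 → j≢i (≡.trans j≡0 (≡.sym i≡0)))))
          (trans (*-cong refl (trans (reflexive (≡.cong (λ a → tent a 0) i≡0)) (tent-peak 0)))
                 (*-identityʳ (lam i)))

  combination-at-N : ∀ lam (i : Fin (ℕ.suc N)) → toℕ i ≡ N → combination lam N ≈ lam i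
  combination-at-N lam i i≡N =
    trans (combination-single lam N i off)
          (trans (*-cong refl (trans (reflexive (≡.cong (λ a → tent a N) i≡N)) (tent-peak N)))
                 (*-identityʳ (lam i)))
    where
    off : ∀ j → toℕ j ≢ toℕ i → tent (toℕ j) N ≈ 0#
    off j j≢i = tent-at-N (ℕP.≤∧≢⇒< (ℕP.≤-pred (FinP.toℕ<n j)) (λ j≡N → j≢i (≡.trans j≡N (≡.sym i≡N))))

  Δ²-combination : ∀ lam {k} (i : Fin (ℕ.suc N)) → toℕ i ≡ ℕ.suc k → 2 ℕ.+ k ≤ N →
                   Δ² (combination lam) k ≈ lam i * Δ² (tent (ℕ.suc k)) k
  Δ²-combination lam {k} i i≡k+1 k+2≤N = begin
    Δ² (combination lam) k
      ≈⟨ δ²-∑ (λ j → lam j * tent (toℕ j) k) (λ j → lam j * tent (toℕ j) (1 ℕ.+ k))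
              (λ j → lam j * tent (toℕ j) (2 ℕ.+ k)) ⟩
    ∑ F (λ j → δ² (lam j * tent (toℕ j) k) (lam j * tent (toℕ j) (1 ℕ.+ k)) (lam j * tent (toℕ j) (2 ℕ.+ k)))
      ≈⟨ ∑-cong {g = λ j → lam j * Δ² (tent (toℕ j)) k} (λ j → δ²-*ˡ (lam j) _ _ _) ⟩
    ∑ F (λ j → lam j * Δ² (tent (toℕ j)) k)
      ≈⟨ ∑-single _ i off ⟩
    lam i * Δ² (tent (toℕ i)) k
      ≈⟨ *-cong refl (reflexive (≡.cong (λ a → Δ² (tent a) k) i≡k+1)) ⟩
    lam i * Δ² (tent (ℕ.suc k)) k ∎
    where
    off : ∀ j → toℕ j ≢ toℕ i → lam j * Δ² (tent (toℕ j)) k ≈ 0#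
    off j j≢i = trans (*-cong refl (Δ²-tent-flat k+2≤N (λ j≡k+1 → j≢i (≡.trans j≡k+1 (≡.sym i≡k+1)))))
                      (zeroʳ (lam j))

  coefficient : (ℕ → Carrier) → ℕ → Carrier
  coefficient y ℕ.zero = y 0
  coefficient y (ℕ.suc k) with ℕ.suc k ℕ.≟ N
  ... | yes _ = y N
  ... | no  _ = - Δ² y k * weight k

  coefficients : (ℕ → Carrier) → V
  coefficients y i = coefficient y (toℕ i)

  coefficient-at-N : ∀ y {m} → m ≡ N → coefficient y m ≈ y N
  coefficient-at-N y {ℕ.zero}  0≡N = reflexive (≡.cong y 0≡N)
  coefficient-at-N y {ℕ.suc k} k+1≡N with ℕ.suc k ℕ.≟ N
  ... | yes _     = refl
  ... | no k+1≢N = ⊥-elim (k+1≢N k+1≡N)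

  coefficient-interior : ∀ y {k} → 2 ℕ.+ k ≤ N → coefficient y (ℕ.suc k) ≈ - Δ² y k * weight k
  coefficient-interior y {k} k+2≤N with ℕ.suc k ℕ.≟ N
  ... | yes k+1≡N = ⊥-elim (ℕP.<⇒≢ k+2≤N k+1≡N)
  ... | no  _     = refl

  interior : ∀ (i : Fin (ℕ.suc N)) {k} → toℕ i ≡ ℕ.suc k → ℕ.suc k ≢ N → 2 ℕ.+ k ≤ N
  interior i i≡k+1 k+1≢N = ℕP.≤∧≢⇒< (ℕP.≤-pred (≡.subst (ℕ._< ℕ.suc N) i≡k+1 (FinP.toℕ<n i))) k+1≢N

  times-minus-one : ∀ {k} → 2 ℕ.+ k ≤ N → ∀ d → d * (Δ² (tent (ℕ.suc k)) k * weight k) ≈ - d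
  times-minus-one k+2≤N d = trans (*-cong refl (Δ²-tent-kink k+2≤N))
                                  (trans (sym (-‿distribʳ-* d 1#)) (-‿cong (*-identityʳ d)))

  kink-cancels : ∀ {k} → 2 ℕ.+ k ≤ N → ∀ d → (- d * weight k) * Δ² (tent (ℕ.suc k)) k ≈ d
  kink-cancels {k} k+2≤N d = begin
    (- d * w) * κ       ≈⟨ *-cong (sym (-‿distribˡ-* d w)) refl ⟩
    - (d * w) * κ       ≈⟨ sym (-‿distribˡ-* (d * w) κ) ⟩
    - ((d * w) * κ)     ≈⟨ -‿cong (trans (*-assoc d w κ) (*-cong refl (*-comm w κ))) ⟩
    - (d * (κ * w))     ≈⟨ -‿cong (times-minus-one k+2≤N d) ⟩
    - - d               ≈⟨ -‿involutive d ⟩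
    d                   ∎
    where
    κ = Δ² (tent (ℕ.suc k)) k
    w = weight k

  kink-cancels′ : ∀ {k} → 2 ℕ.+ k ≤ N → ∀ d → - (d * Δ² (tent (ℕ.suc k)) k) * weight k ≈ d
  kink-cancels′ {k} k+2≤N d = begin
    - (d * κ) * w       ≈⟨ sym (-‿distribˡ-* (d * κ) w) ⟩
    - ((d * κ) * w)     ≈⟨ -‿cong (*-assoc d κ w) ⟩
    - (d * (κ * w))     ≈⟨ -‿cong (times-minus-one k+2≤N d) ⟩
    - - d               ≈⟨ -‿involutive d ⟩
    d                   ∎
    where
    κ = Δ² (tent (ℕ.suc k)) k
    w = weight k

  coefficients-of-combination : ∀ mu i → coefficients (combination mu) i ≈ mu i
  coefficients-of-combination mu i with toℕ i in i≡m
  ... | ℕ.zero = combination-at-0 mu i i≡m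
  ... | ℕ.suc k with ℕ.suc k ℕ.≟ N
  ...   | yes k+1≡N = combination-at-N mu i (≡.trans i≡m k+1≡N)
  ...   | no  k+1≢N = begin
    - Δ² (combination mu) k * weight k
      ≈⟨ *-cong (-‿cong (Δ²-combination mu i i≡m k+2≤N)) refl ⟩
    - (mu i * Δ² (tent (ℕ.suc k)) k) * weight k
      ≈⟨ kink-cancels′ k+2≤N (mu i) ⟩
    mu i ∎
    where
    k+2≤N = interior i i≡m k+1≢N

  combination-of-coefficients : ∀ y m → m ≤ N → y m ≈ combination (coefficients y) m
  combination-of-coefficients y = determined y (combination lam)
    (sym (combination-at-0 lam fzero ≡.refl))
    (sym (trans (combination-at-N lam (fromℕ N) (FinP.toℕ-fromℕ N))
                (coefficient-at-N y (FinP.toℕ-fromℕ N))))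
    Δ²-agree
    where
    lam = coefficients y
    Δ²-agree : ∀ k → 2 ℕ.+ k ≤ N → Δ² y k ≈ Δ² (combination lam) k
    Δ²-agree k k+2≤N = sym (begin
      Δ² (combination lam) k
        ≈⟨ Δ²-combination lam i (FinP.toℕ-fromℕ< k+1<N+1) k+2≤N ⟩
      lam i * Δ² (tent (ℕ.suc k)) k
        ≈⟨ *-cong (trans (reflexive (≡.cong (coefficient y) (FinP.toℕ-fromℕ< k+1<N+1)))
                         (coefficient-interior y k+2≤N)) refl ⟩
      (- Δ² y k * weight k) * Δ² (tent (ℕ.suc k)) k
        ≈⟨ kink-cancels k+2≤N (Δ² y k) ⟩
      Δ² y k ∎)
      where
      k+1<N+1 : ℕ.suc k ℕ.< ℕ.suc N
      k+1<N+1 = ℕ.s≤s (ℕP.<⇒≤ k+2≤N)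
      i = fromℕ< k+1<N+1

  coefficients-cong : ∀ y z → (∀ m → m ≤ N → y m ≈ z m) → ∀ i → coefficients y i ≈ coefficients z i
  coefficients-cong y z y≈z i with toℕ i in i≡m
  ... | ℕ.zero = y≈z 0 ℕ.z≤n
  ... | ℕ.suc k with ℕ.suc k ℕ.≟ N
  ...   | yes _     = y≈z N ℕP.≤-refl
  ...   | no  k+1≢N = *-cong (-‿cong (δ²-cong (y≈z k (ℕP.≤-trans (ℕP.n≤1+n k) k+1≤N))
                                              (y≈z (ℕ.suc k) k+1≤N) (y≈z (2 ℕ.+ k) k+2≤N))) refl
    where
    k+2≤N = interior i i≡m k+1≢N
    k+1≤N = ℕP.<⇒≤ k+2≤N

  coefficients-nonneg : ∀ y → (∀ m → m ≤ N → 0# ≤ᶠ y m) →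
                        (∀ k → 2 ℕ.+ k ≤ N → 0# ≤ᶠ - Δ² y k) → ∀ i → 0# ≤ᶠ coefficients y i
  coefficients-nonneg y y≥0 concave i with toℕ i in i≡m
  ... | ℕ.zero = y≥0 0 ℕ.z≤n
  ... | ℕ.suc k with ℕ.suc k ℕ.≟ N
  ...   | yes _     = y≥0 N ℕP.≤-refl
  ...   | no  k+1≢N = *-nonneg (concave k k+2≤N) (weight-nonneg k N≢0)
    where
    k+2≤N = interior i i≡m k+1≢N
    N≢0 : N ≢ 0
    N≢0 = ℕP.m<n⇒n≢0 k+2≤N

  coordinates : V → V
  coordinates x = coefficients (extend x)

  private
    index : ∀ {m} → m ≤ N → Fin (ℕ.suc N)
    index m≤N = fromℕ< (ℕ.s≤s m≤N)

    toℕ-index : ∀ {m} (m≤N : m ≤ N) → toℕ (index m≤N) ≡ m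
    toℕ-index m≤N = FinP.toℕ-fromℕ< (ℕ.s≤s m≤N)

    extend-index : ∀ (x : V) {m} (m≤N : m ≤ N) → extend x m ≡ x (index m≤N)
    extend-index x m≤N = extend-fromℕ< x (ℕ.s≤s m≤N)

  coordinates-represent : ∀ x → _≈ᵛ_ F x (lincomb F (minc F (ℕ.suc N)) (coordinates x))
  coordinates-represent x j = begin
    x j                                        ≡⟨ ≡.sym (extend-toℕ x j) ⟩
    extend x (toℕ j)                           ≈⟨ combination-of-coefficients (extend x) (toℕ j)
                                                    (ℕP.≤-pred (FinP.toℕ<n j)) ⟩
    combination (coordinates x) (toℕ j)        ≈⟨ sym (lincomb≈combination (coordinates x) j) ⟩
    lincomb F (minc F (ℕ.suc N)) (coordinates x) j ∎

  coordinates-unique : ∀ x mu → _≈ᵛ_ F x (lincomb F (minc F (ℕ.suc N)) mu) → _≈ᵛ_ F (coordinates x) mu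
  coordinates-unique x mu x≈mu i =
    trans (coefficients-cong (extend x) (combination mu) agree i) (coefficients-of-combination mu i)
    where
    agree : ∀ m → m ≤ N → extend x m ≈ combination mu m
    agree m m≤N = begin
      extend x m                                  ≡⟨ extend-index x m≤N ⟩
      x (index m≤N)                               ≈⟨ x≈mu (index m≤N) ⟩
      lincomb F (minc F (ℕ.suc N)) mu (index m≤N) ≈⟨ lincomb≈combination mu (index m≤N) ⟩
      combination mu (toℕ (index m≤N))            ≡⟨ ≡.cong (combination mu) (toℕ-index m≤N) ⟩
      combination mu m                            ∎

  coordinates-nonneg : ∀ x → Positive F x → Concave F x → Positive F (coordinates x)
  coordinates-nonneg x x≥0 concave = coefficients-nonneg (extend x) extend≥0 extend-concave
    where
    extend≥0 : ∀ m → m ≤ N → 0# ≤ᶠ extend x m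
    extend≥0 m m≤N = ≤-resp refl (reflexive (≡.sym (extend-index x m≤N))) (x≥0 (index m≤N))
    extend-concave : ∀ k → 2 ℕ.+ k ≤ N → 0# ≤ᶠ - Δ² (extend x) k
    extend-concave k k+2≤N = ≤-resp refl (trans values (δ²-neg _ _ _))
      (concave (index k≤N) (index k+1≤N) (index k+2≤N)
        (≡.trans (toℕ-index k+1≤N) (≡.cong ℕ.suc (≡.sym (toℕ-index k≤N))))
        (≡.trans (toℕ-index k+2≤N) (≡.cong ℕ.suc (≡.sym (toℕ-index k+1≤N)))))
      where
      k+1≤N = ℕP.<⇒≤ k+2≤N
      k≤N = ℕP.≤-trans (ℕP.n≤1+n k) k+1≤N
      at : ∀ {m} (m≤N : m ≤ N) → - x (index m≤N) ≈ - extend x m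
      at m≤N = -‿cong (reflexive (≡.sym (extend-index x m≤N)))
      values : δ² (- x (index k≤N)) (- x (index k+1≤N)) (- x (index k+2≤N))
                 ≈ δ² (- extend x k) (- extend x (1 ℕ.+ k)) (- extend x (2 ℕ.+ k))
      values = δ²-cong (at k≤N) (at k+1≤N) (at k+2≤N)

mainTheorem1 : ∀ {c ℓ₁ ℓ₂ : Level} (F : OrderedField c ℓ₁ ℓ₂) (n : ℕ) → 1 ≤ n →
    IsBasis F (minc F n) ×
    (∀ (x : Vector F n) → Positive F x → Concave F x →
      Σ (Vector F n) λ lam → Positive F lam × (_≈ᵛ_ F x (lincomb F (minc F n) lam)) ×
        (∀ (mu : Vector F n) → Positive F mu → _≈ᵛ_ F x (lincomb F (minc F n) mu) → _≈ᵛ_ F lam mu))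
mainTheorem1 F ℕ.zero    ()
mainTheorem1 F (ℕ.suc N) _ = basis , nonnegative-coordinates
  where
  open Coordinates F N
  basis : IsBasis F (minc F (ℕ.suc N))
  basis x = coordinates x , coordinates-represent x , coordinates-unique x
  nonnegative-coordinates : ∀ (x : V) → Positive F x → Concave F x →
    Σ V λ lam → Positive F lam × (_≈ᵛ_ F x (lincomb F (minc F (ℕ.suc N)) lam)) ×
      (∀ (mu : V) → Positive F mu → _≈ᵛ_ F x (lincomb F (minc F (ℕ.suc N)) mu) → _≈ᵛ_ F lam mu)
  nonnegative-coordinates x x≥0 concave =
    coordinates x , coordinates-nonneg x x≥0 concave , coordinates-represent x ,
    λ mu _ → coordinates-unique x mu
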